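{- Let $G$ be an anti-matching on at least four vertices. Then the maximum size of an acyclic matching of $G$ equals $2$.
   Context: All graphs are finite and simple. An anti-matching is a bipartite graph with bipartition $(X,Y)$, $|X|=|Y|$, together with a bijection $f:X\to Y$ such that every $v\in X$ is adjacent to every vertex of $Y$ except $f(v)$ (and there are no other edges). A matching $M$ is acyclic if the subgraph of $G$ induced on the endpoints of the edges of $M$ is acyclic. -}

module Defs where

open import Data.Nat using (ℕ; _≤_)
open import Data.Fin using (Fin)
open import Data.Bool using (Bool; true; false)
open import Data.List using (List; []; _∷_; length; concatMap; map)
open import Data.List.Relation.Unary.All using (All)
open import Data.List.Relation.Unary.Unique.Propositional using (Unique)
open import Data.List.Membership.Propositional using (_∈_)
open import Data.Product using (Σ; _×_; _,_; proj₁; proj₂; ∃)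
open import Relation.Nullary using (¬_)
open import Relation.Binary.PropositionalEquality using (_≡_; _≢_)
open import Function.Bundles using (_⇔_)

record Graph (n : ℕ) : Set₁ where
  field
    Adj   : Fin n → Fin n → Set
    sym   : ∀ {u v} → Adj u v → Adj v u
    irrefl : ∀ {u} → ¬ Adj u u
open Graph public

-- G is an anti-matching: there is a bipartition (X = side true, Y = side false)
-- and a bijection f : X → Y (given as a function on Fin n, only its values on X matter)
-- such that the edges are exactly the pairs x ∈ X, y ∈ Y with y ≠ f x.
IsAntiMatching : ∀ {n} → Graph n → Set
IsAntiMatching {n} G =
  Σ (Fin n → Bool) λ side →
  Σ (Fin n → Fin n) λ f →
    (∀ x → side x ≡ true → side (f x) ≡ false)
  × (∀ x x' → side x ≡ true → side x' ≡ true → f x ≡ f x' → x ≡ x')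
  × (∀ y → side y ≡ false → Σ (Fin n) λ x → side x ≡ true × f x ≡ y)
  × (∀ x y → side x ≡ true → side y ≡ false → (Adj G x y ⇔ y ≢ f x))
  × (∀ u v → side u ≡ side v → ¬ Adj G u v)

Edge : ℕ → Set
Edge n = Fin n × Fin n

endpoints : ∀ {n} → List (Edge n) → List (Fin n)
endpoints = concatMap (λ e → proj₁ e ∷ proj₂ e ∷ [])

IsMatching : ∀ {n} → Graph n → List (Edge n) → Set
IsMatching G M = All (λ e → Adj G (proj₁ e) (proj₂ e)) M × Unique (endpoints M)

data IsPath {n} (G : Graph n) : List (Fin n) → Set where
  single : ∀ v → IsPath G (v ∷ [])
  step   : ∀ u v vs → Adj G u v → IsPath G (v ∷ vs) → IsPath G (u ∷ v ∷ vs)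

last : ∀ {n} → Fin n → List (Fin n) → Fin n
last v [] = v
last _ (w ∷ ws) = last w ws

IsInducedCycle : ∀ {n} → Graph n → (Fin n → Set) → List (Fin n) → Set
IsInducedCycle G S [] = Data.Empty.⊥
  where import Data.Empty
IsInducedCycle G S (v ∷ vs) =
  3 ≤ length (v ∷ vs) × Unique (v ∷ vs) × All S (v ∷ vs)
  × IsPath G (v ∷ vs) × Adj G (last v vs) v

InducedAcyclic : ∀ {n} → Graph n → (Fin n → Set) → Set
InducedAcyclic G S = ∀ cs → ¬ IsInducedCycle G S cs

IsAcyclicMatching : ∀ {n} → Graph n → List (Edge n) → Set
IsAcyclicMatching G M = IsMatching G M × InducedAcyclic G (λ v → v ∈ endpoints M)

MaxAcyclicMatchingSize : ∀ {n} → Graph n → ℕ → Set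
MaxAcyclicMatchingSize G k =
  (Σ (List (Edge _)) λ M → IsAcyclicMatching G M × length M ≡ k)
  × (∀ M → IsAcyclicMatching G M → length M ≤ k)

{-# OPTIONS --safe #-}
module Submission where

-- Two distinct vertices x₁, x₂ of X give the matching x₁ f(x₂), x₂ f(x₁); since x₁ f(x₁) and
-- x₂ f(x₂) are non-edges, it is an induced matching and hence acyclic. Conversely, take three
-- matching edges xᵢ yᵢ. The non-edges xᵢ yⱼ (i ≠ j, that is yⱼ = f(xᵢ)) form a partial
-- matching between the xᵢ and the yⱼ, because f is an injective function. Hence either some
-- pair i, j has both cross pairs xᵢ yⱼ, xⱼ yᵢ as edges, closing the 4-cycle xᵢ yⱼ xⱼ yᵢ, or
-- the non-edges are one cyclic orientation of the indices and the other orientation closes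
-- a 6-cycle through all six vertices.

open import Defs
open import Data.Nat using (ℕ; _≤_; s≤s; z≤n)
open import Data.Fin using (Fin; _≟_) renaming (zero to fzero; suc to fsuc)
open import Data.Bool using (Bool; true; false)
open import Data.List using (List; []; _∷_; length)
open import Data.List.Relation.Unary.All using (All; []; _∷_)
open import Data.List.Relation.Unary.Any using (here; there)
open import Data.List.Relation.Unary.AllPairs using ([]; _∷_)
open import Data.List.Membership.Propositional using (_∈_)
open import Data.Product using (Σ; _×_; _,_; proj₂)
open import Data.Sum using (_⊎_; inj₁; inj₂)
open import Data.Empty using (⊥; ⊥-elim)
open import Relation.Nullary using (¬_; yes; no)
open import Relation.Binary.PropositionalEquality
  using (_≡_; _≢_; refl; trans; cong; ≢-sym) renaming (sym to ≡-sym)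
open import Function using (_∘′_)
open import Function.Bundles using (Equivalence; _⇔_)

Bool-pigeonhole : (a b c : Bool) → a ≡ b ⊎ a ≡ c ⊎ b ≡ c
Bool-pigeonhole true  true  _     = inj₁ refl
Bool-pigeonhole false false _     = inj₁ refl
Bool-pigeonhole true  false true  = inj₂ (inj₁ refl)
Bool-pigeonhole false true  false = inj₂ (inj₁ refl)
Bool-pigeonhole true  false false = inj₂ (inj₂ refl)
Bool-pigeonhole false true  true  = inj₂ (inj₂ refl)

≤1-neighbour⇒inducedAcyclic : ∀ {n} (G : Graph n) (S : Fin n → Set) →
  (∀ {u w w′} → S u → S w → S w′ → Adj G u w → Adj G u w′ → w ≡ w′) →
  InducedAcyclic G S
≤1-neighbour⇒inducedAcyclic G S ≤1 [] ()
≤1-neighbour⇒inducedAcyclic G S ≤1 (_ ∷ []) (s≤s () , _)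
≤1-neighbour⇒inducedAcyclic G S ≤1 (_ ∷ _ ∷ []) (s≤s (s≤s ()) , _)
≤1-neighbour⇒inducedAcyclic G S ≤1 (_ ∷ _ ∷ _ ∷ _)
  (_ , ((_ ∷ v₀≢v₂ ∷ _) ∷ _) , (S₀ ∷ S₁ ∷ S₂ ∷ _) , step _ _ _ a₀₁ (step _ _ _ a₁₂ _) , _) =
  v₀≢v₂ (≤1 S₁ S₀ S₂ (Graph.sym G a₀₁) a₁₂)

endpoint∈ : ∀ {A : Set} {u a b : A} {xs : List A} → u ≡ a ⊎ u ≡ b → u ∈ a ∷ b ∷ xs
endpoint∈ (inj₁ refl) = here refl
endpoint∈ (inj₂ refl) = there (here refl)

disjoint⇒endpoints≢ : ∀ {A : Set} {u v a b c d : A} → u ≡ a ⊎ u ≡ b → v ≡ c ⊎ v ≡ d →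
  a ≢ c → a ≢ d → b ≢ c → b ≢ d → u ≢ v
disjoint⇒endpoints≢ (inj₁ refl) (inj₁ refl) a≢c _   _   _   = a≢c
disjoint⇒endpoints≢ (inj₁ refl) (inj₂ refl) _   a≢d _   _   = a≢d
disjoint⇒endpoints≢ (inj₂ refl) (inj₁ refl) _   _   b≢c _   = b≢c
disjoint⇒endpoints≢ (inj₂ refl) (inj₂ refl) _   _   _   b≢d = b≢d

module AntiMatching {n : ℕ} (G : Graph n) (side : Fin n → Bool) (f : Fin n → Fin n)
  (f-X→Y : ∀ x → side x ≡ true → side (f x) ≡ false)
  (f-injective : ∀ x x′ → side x ≡ true → side x′ ≡ true → f x ≡ f x′ → x ≡ x′)
  (f-surjective : ∀ y → side y ≡ false → Σ (Fin n) λ x → side x ≡ true × f x ≡ y)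
  (adj⇔ : ∀ x y → side x ≡ true → side y ≡ false → (Adj G x y ⇔ y ≢ f x))
  (sameSide⇒nonadj : ∀ u v → side u ≡ side v → ¬ Adj G u v) where

  X Y : Fin n → Set
  X v = side v ≡ true
  Y v = side v ≡ false

  X≢Y : ∀ {u v} → X u → Y v → u ≢ v
  X≢Y Xu Yv refl with trans (≡-sym Xu) Yv
  ... | ()

  X-nonadj : ∀ {u v} → X u → X v → ¬ Adj G u v
  X-nonadj Xu Xv = sameSide⇒nonadj _ _ (trans Xu (≡-sym Xv))

  Y-nonadj : ∀ {u v} → Y u → Y v → ¬ Adj G u v
  Y-nonadj Yu Yv = sameSide⇒nonadj _ _ (trans Yu (≡-sym Yv))

  adj-XY : ∀ {x y} → X x → Y y → y ≢ f x → Adj G x y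
  adj-XY Xx Yy = Equivalence.from (adj⇔ _ _ Xx Yy)

  nonadj-f : ∀ {x} → X x → ¬ Adj G x (f x)
  nonadj-f Xx a = Equivalence.to (adj⇔ _ _ Xx (f-X→Y _ Xx)) a refl

  f-≢ : ∀ {x x′} → X x → X x′ → x ≢ x′ → f x ≢ f x′
  f-≢ Xx Xx′ x≢x′ = x≢x′ ∘′ f-injective _ _ Xx Xx′

  -- y ≡ f x says that x y is the only non-edge at x, and (f being injective) the only one at y.
  nonEdge-uniqueʸ : ∀ {x y y′} → y ≡ f x → y ≢ y′ → y′ ≢ f x
  nonEdge-uniqueʸ y≡fx y≢y′ y′≡fx = y≢y′ (trans y≡fx (≡-sym y′≡fx))

  nonEdge-uniqueˣ : ∀ {x x′ y} → X x → X x′ → y ≡ f x → x ≢ x′ → y ≢ f x′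
  nonEdge-uniqueˣ Xx Xx′ y≡fx x≢x′ y≡fx′ = f-≢ Xx Xx′ x≢x′ (trans (≡-sym y≡fx) y≡fx′)

  TwoDistinctX : Set
  TwoDistinctX = Σ (Fin n) λ x₁ → Σ (Fin n) λ x₂ → X x₁ × X x₂ × x₁ ≢ x₂

  sameSide⇒twoDistinctX : ∀ {u v} → u ≢ v → side u ≡ side v → TwoDistinctX
  sameSide⇒twoDistinctX {u} {v} u≢v eq with side u in su
  ... | true  = u , v , su , ≡-sym eq , u≢v
  ... | false with f-surjective u su | f-surjective v (≡-sym eq)
  ...   | xu , Xxu , refl | xv , Xxv , refl = xu , xv , Xxu , Xxv , λ xu≡xv → u≢v (cong f xu≡xv)

  threeVertices⇒twoDistinctX : ∀ {v₀ v₁ v₂} → v₀ ≢ v₁ → v₀ ≢ v₂ → v₁ ≢ v₂ → TwoDistinctX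
  threeVertices⇒twoDistinctX {v₀} {v₁} {v₂} v₀≢v₁ v₀≢v₂ v₁≢v₂
    with Bool-pigeonhole (side v₀) (side v₁) (side v₂)
  ... | inj₁ eq        = sameSide⇒twoDistinctX v₀≢v₁ eq
  ... | inj₂ (inj₁ eq) = sameSide⇒twoDistinctX v₀≢v₂ eq
  ... | inj₂ (inj₂ eq) = sameSide⇒twoDistinctX v₁≢v₂ eq

  acyclicMatchingOfSize2 : TwoDistinctX →
    Σ (List (Edge n)) λ M → IsAcyclicMatching G M × length M ≡ 2
  acyclicMatchingOfSize2 (x₁ , x₂ , X₁ , X₂ , x₁≢x₂) =
    (x₁ , f x₂) ∷ (x₂ , f x₁) ∷ [] ,
    (((adj-XY X₁ Y₂ (≢-sym fx₁≢fx₂) ∷ adj-XY X₂ Y₁ fx₁≢fx₂ ∷ []) , unique) ,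
     ≤1-neighbour⇒inducedAcyclic G (_∈ L) (λ u w w′ a a′ → trans (matched u w a) (≡-sym (matched u w′ a′)))) ,
    refl
    where
    Y₁ = f-X→Y x₁ X₁
    Y₂ = f-X→Y x₂ X₂
    fx₁≢fx₂ = f-≢ X₁ X₂ x₁≢x₂

    L : List (Fin n)
    L = x₁ ∷ f x₂ ∷ x₂ ∷ f x₁ ∷ []

    unique = (X≢Y X₁ Y₂ ∷ x₁≢x₂ ∷ X≢Y X₁ Y₁ ∷ [])
           ∷ (≢-sym (X≢Y X₂ Y₂) ∷ ≢-sym fx₁≢fx₂ ∷ [])
           ∷ (X≢Y X₂ Y₁ ∷ [])
           ∷ [] ∷ []

    partner : ∀ {u} → u ∈ L → Fin n
    partner (here _)                         = f x₂
    partner (there (here _))                 = x₁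
    partner (there (there (here _)))         = f x₁
    partner (there (there (there (here _)))) = x₂

    matched : ∀ {u w} (u∈L : u ∈ L) → w ∈ L → Adj G u w → w ≡ partner u∈L
    matched (here refl) (here refl)                         a = ⊥-elim (Graph.irrefl G a)
    matched (here refl) (there (here refl))                 a = refl
    matched (here refl) (there (there (here refl)))         a = ⊥-elim (X-nonadj X₁ X₂ a)
    matched (here refl) (there (there (there (here refl)))) a = ⊥-elim (nonadj-f X₁ a)
    matched (there (here refl)) (here refl)                         a = refl
    matched (there (here refl)) (there (here refl))                 a = ⊥-elim (Graph.irrefl G a)
    matched (there (here refl)) (there (there (here refl)))         a = ⊥-elim (nonadj-f X₂ (Graph.sym G a))
    matched (there (here refl)) (there (there (there (here refl)))) a = ⊥-elim (Y-nonadj Y₂ Y₁ a)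
    matched (there (there (here refl))) (here refl)                         a = ⊥-elim (X-nonadj X₂ X₁ a)
    matched (there (there (here refl))) (there (here refl))                 a = ⊥-elim (nonadj-f X₂ a)
    matched (there (there (here refl))) (there (there (here refl)))         a = ⊥-elim (Graph.irrefl G a)
    matched (there (there (here refl))) (there (there (there (here refl)))) a = refl
    matched (there (there (there (here refl)))) (here refl)                         a = ⊥-elim (nonadj-f X₁ (Graph.sym G a))
    matched (there (there (there (here refl)))) (there (here refl))                 a = ⊥-elim (Y-nonadj Y₁ Y₂ a)
    matched (there (there (there (here refl)))) (there (there (here refl)))         a = refl
    matched (there (there (there (here refl)))) (there (there (there (here refl)))) a = ⊥-elim (Graph.irrefl G a)
    matched (there (there (there (there ())))) _ _
    matched (here refl) (there (there (there (there ())))) _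
    matched (there (here refl)) (there (there (there (there ())))) _
    matched (there (there (here refl))) (there (there (there (there ())))) _
    matched (there (there (there (here refl)))) (there (there (there (there ())))) _

  square : ∀ {S : Fin n → Set} {a b c d} → X a → Y b → X c → Y d → a ≢ c → b ≢ d →
    All S (a ∷ b ∷ c ∷ d ∷ []) →
    Adj G a b → Adj G b c → Adj G c d → Adj G d a → IsInducedCycle G S (a ∷ b ∷ c ∷ d ∷ [])
  square Xa Yb Xc Yd a≢c b≢d S-all ab bc cd da =
    s≤s (s≤s (s≤s z≤n)) ,
    ( (X≢Y Xa Yb ∷ a≢c ∷ X≢Y Xa Yd ∷ [])
    ∷ (≢-sym (X≢Y Xc Yb) ∷ b≢d ∷ [])
    ∷ (X≢Y Xc Yd ∷ [])
    ∷ [] ∷ []) ,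
    S-all ,
    step _ _ _ ab (step _ _ _ bc (step _ _ _ cd (single _))) ,
    da

  hexagon : ∀ {S : Fin n → Set} {a b c d e g} → X a → Y b → X c → Y d → X e → Y g →
    a ≢ c → a ≢ e → c ≢ e → b ≢ d → b ≢ g → d ≢ g →
    All S (a ∷ b ∷ c ∷ d ∷ e ∷ g ∷ []) →
    Adj G a b → Adj G b c → Adj G c d → Adj G d e → Adj G e g → Adj G g a →
    IsInducedCycle G S (a ∷ b ∷ c ∷ d ∷ e ∷ g ∷ [])
  hexagon Xa Yb Xc Yd Xe Yg a≢c a≢e c≢e b≢d b≢g d≢g S-all ab bc cd de eg ga =
    s≤s (s≤s (s≤s z≤n)) ,
    ( (X≢Y Xa Yb ∷ a≢c ∷ X≢Y Xa Yd ∷ a≢e ∷ X≢Y Xa Yg ∷ [])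
    ∷ (≢-sym (X≢Y Xc Yb) ∷ b≢d ∷ ≢-sym (X≢Y Xe Yb) ∷ b≢g ∷ [])
    ∷ (X≢Y Xc Yd ∷ c≢e ∷ X≢Y Xc Yg ∷ [])
    ∷ (≢-sym (X≢Y Xe Yd) ∷ d≢g ∷ [])
    ∷ (X≢Y Xe Yg ∷ [])
    ∷ [] ∷ []) ,
    S-all ,
    step _ _ _ ab (step _ _ _ bc (step _ _ _ cd (step _ _ _ de (step _ _ _ eg (single _))))) ,
    ga

  threeEdges⇒inducedCycle : ∀ {S : Fin n → Set} {x₁ x₂ x₃ y₁ y₂ y₃} →
    X x₁ → X x₂ → X x₃ → Y y₁ → Y y₂ → Y y₃ →
    All S (x₁ ∷ y₁ ∷ x₂ ∷ y₂ ∷ x₃ ∷ y₃ ∷ []) →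
    Adj G x₁ y₁ → Adj G x₂ y₂ → Adj G x₃ y₃ →
    x₁ ≢ x₂ → x₁ ≢ x₃ → x₂ ≢ x₃ → y₁ ≢ y₂ → y₁ ≢ y₃ → y₂ ≢ y₃ →
    Σ (List (Fin n)) (IsInducedCycle G S)
  threeEdges⇒inducedCycle {x₁ = x₁} {x₂} {x₃} {y₁} {y₂} {y₃} X₁ X₂ X₃ Y₁ Y₂ Y₃
    (S-x₁ ∷ S-y₁ ∷ S-x₂ ∷ S-y₂ ∷ S-x₃ ∷ S-y₃ ∷ []) e₁ e₂ e₃ x₁≢x₂ x₁≢x₃ x₂≢x₃ y₁≢y₂ y₁≢y₃ y₂≢y₃
    with y₂ ≟ f x₁ | y₁ ≟ f x₂
  ... | no y₂≢fx₁ | no y₁≢fx₂ =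
    _ , square X₁ Y₂ X₂ Y₁ x₁≢x₂ (≢-sym y₁≢y₂) (S-x₁ ∷ S-y₂ ∷ S-x₂ ∷ S-y₁ ∷ [])
          (adj-XY X₁ Y₂ y₂≢fx₁) (Graph.sym G e₂) (adj-XY X₂ Y₁ y₁≢fx₂) (Graph.sym G e₁)
  ... | yes y₂≡fx₁ | yes y₁≡fx₂ =
    _ , square X₁ Y₃ X₃ Y₁ x₁≢x₃ (≢-sym y₁≢y₃) (S-x₁ ∷ S-y₃ ∷ S-x₃ ∷ S-y₁ ∷ [])
          (adj-XY X₁ Y₃ (nonEdge-uniqueʸ y₂≡fx₁ y₂≢y₃)) (Graph.sym G e₃)
          (adj-XY X₃ Y₁ (nonEdge-uniqueˣ X₂ X₃ y₁≡fx₂ x₂≢x₃)) (Graph.sym G e₁)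
  ... | yes y₂≡fx₁ | no y₁≢fx₂ =
    _ , hexagon X₁ Y₃ X₃ Y₂ X₂ Y₁ x₁≢x₃ x₁≢x₂ (≢-sym x₂≢x₃) (≢-sym y₂≢y₃) (≢-sym y₁≢y₃) (≢-sym y₁≢y₂)
          (S-x₁ ∷ S-y₃ ∷ S-x₃ ∷ S-y₂ ∷ S-x₂ ∷ S-y₁ ∷ [])
          (adj-XY X₁ Y₃ (nonEdge-uniqueʸ y₂≡fx₁ y₂≢y₃)) (Graph.sym G e₃)
          (adj-XY X₃ Y₂ (nonEdge-uniqueˣ X₁ X₃ y₂≡fx₁ x₁≢x₃)) (Graph.sym G e₂)
          (adj-XY X₂ Y₁ y₁≢fx₂) (Graph.sym G e₁)
  ... | no y₂≢fx₁ | yes y₁≡fx₂ =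
    _ , hexagon X₁ Y₂ X₂ Y₃ X₃ Y₁ x₁≢x₂ x₁≢x₃ x₂≢x₃ y₂≢y₃ (≢-sym y₁≢y₂) (≢-sym y₁≢y₃)
          (S-x₁ ∷ S-y₂ ∷ S-x₂ ∷ S-y₃ ∷ S-x₃ ∷ S-y₁ ∷ [])
          (adj-XY X₁ Y₂ y₂≢fx₁) (Graph.sym G e₂)
          (adj-XY X₂ Y₃ (nonEdge-uniqueʸ y₁≡fx₂ y₁≢y₃)) (Graph.sym G e₃)
          (adj-XY X₃ Y₁ (nonEdge-uniqueˣ X₂ X₃ y₁≡fx₂ x₂≢x₃)) (Graph.sym G e₁)

  orient : ∀ {a b} → Adj G a b → Σ (Fin n) λ x → Σ (Fin n) λ y →
    X x × Y y × Adj G x y × (x ≡ a ⊎ x ≡ b) × (y ≡ a ⊎ y ≡ b)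
  orient {a} {b} ab with side a in sa | side b in sb
  ... | true  | true  = ⊥-elim (X-nonadj sa sb ab)
  ... | false | false = ⊥-elim (Y-nonadj sa sb ab)
  ... | true  | false = a , b , sa , sb , ab , inj₁ refl , inj₂ refl
  ... | false | true  = b , a , sb , sa , Graph.sym G ab , inj₂ refl , inj₁ refl

  acyclicMatching≤2 : ∀ M → IsAcyclicMatching G M → length M ≤ 2
  acyclicMatching≤2 [] _ = z≤n
  acyclicMatching≤2 (_ ∷ []) _ = s≤s z≤n
  acyclicMatching≤2 (_ ∷ _ ∷ []) _ = s≤s (s≤s z≤n)
  acyclicMatching≤2 ((a₁ , b₁) ∷ (a₂ , b₂) ∷ (a₃ , b₃) ∷ _)
    (((ab₁ ∷ ab₂ ∷ ab₃ ∷ _) ,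
      ((_ ∷ a₁≢a₂ ∷ a₁≢b₂ ∷ a₁≢a₃ ∷ a₁≢b₃ ∷ _) ∷ (b₁≢a₂ ∷ b₁≢b₂ ∷ b₁≢a₃ ∷ b₁≢b₃ ∷ _) ∷
       (_ ∷ a₂≢a₃ ∷ a₂≢b₃ ∷ _) ∷ (b₂≢a₃ ∷ b₂≢b₃ ∷ _) ∷ _)) , acyclic)
    with orient ab₁ | orient ab₂ | orient ab₃
  ... | x₁ , y₁ , X₁ , Y₁ , e₁ , x₁∈ , y₁∈ | x₂ , y₂ , X₂ , Y₂ , e₂ , x₂∈ , y₂∈
      | x₃ , y₃ , X₃ , Y₃ , e₃ , x₃∈ , y₃∈ =
    ⊥-elim (acyclic _ (proj₂ (threeEdges⇒inducedCycle X₁ X₂ X₃ Y₁ Y₂ Y₃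
      ( endpoint∈ x₁∈ ∷ endpoint∈ y₁∈
      ∷ there (there (endpoint∈ x₂∈)) ∷ there (there (endpoint∈ y₂∈))
      ∷ there (there (there (there (endpoint∈ x₃∈)))) ∷ there (there (there (there (endpoint∈ y₃∈))))
      ∷ [])
      e₁ e₂ e₃
      (≢₁₂ x₁∈ x₂∈) (≢₁₃ x₁∈ x₃∈) (≢₂₃ x₂∈ x₃∈) (≢₁₂ y₁∈ y₂∈) (≢₁₃ y₁∈ y₃∈) (≢₂₃ y₂∈ y₃∈))))
    where
    ≢₁₂ : ∀ {u v} → u ≡ a₁ ⊎ u ≡ b₁ → v ≡ a₂ ⊎ v ≡ b₂ → u ≢ v
    ≢₁₂ u∈ v∈ = disjoint⇒endpoints≢ u∈ v∈ a₁≢a₂ a₁≢b₂ b₁≢a₂ b₁≢b₂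
    ≢₁₃ : ∀ {u v} → u ≡ a₁ ⊎ u ≡ b₁ → v ≡ a₃ ⊎ v ≡ b₃ → u ≢ v
    ≢₁₃ u∈ v∈ = disjoint⇒endpoints≢ u∈ v∈ a₁≢a₃ a₁≢b₃ b₁≢a₃ b₁≢b₃
    ≢₂₃ : ∀ {u v} → u ≡ a₂ ⊎ u ≡ b₂ → v ≡ a₃ ⊎ v ≡ b₃ → u ≢ v
    ≢₂₃ u∈ v∈ = disjoint⇒endpoints≢ u∈ v∈ a₂≢a₃ a₂≢b₃ b₂≢a₃ b₂≢b₃

proposition3 : (n : ℕ) (G : Graph n) → 4 ≤ n → IsAntiMatching G →
    MaxAcyclicMatchingSize G 2
proposition3 _ G (s≤s (s≤s (s≤s _)))
  (side , f , f-X→Y , f-injective , f-surjective , adj⇔ , sameSide⇒nonadj) =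
  acyclicMatchingOfSize2 twoDistinctX , acyclicMatching≤2
  where
  open AntiMatching G side f f-X→Y f-injective f-surjective adj⇔ sameSide⇒nonadj

  twoDistinctX : TwoDistinctX
  twoDistinctX =
    threeVertices⇒twoDistinctX {fzero} {fsuc fzero} {fsuc (fsuc fzero)} (λ ()) (λ ()) (λ ())
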